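{- Let $D$ be a finite simple digraph and $(T,\beta,\gamma)$ an $\mathrm{SC}^\infty_\emptyset$-directed tree decomposition of $D$ of width $k$. Then there exists an $\mathrm{SC}^\infty_\emptyset$-directed tree decomposition $(T',\beta',\gamma')$ of $D$ of width at most $k$ such that $|\beta'(r)|\le 1$ for all $r\in V(T')$.
   Context: An abstract digraph decomposition of $D$ is a triple $(T,\beta,\gamma)$ with $T$ a rooted directed tree (edges directed away from the root), $\beta:V(T)\to 2^{V(D)}$, $\gamma:E(T)\to 2^{V(D)}$, $\bigcup_t\beta(t)=V(D)$. Let $\Gamma(t)=\beta(t)\cup\bigcup_{e\text{ incident with }t}\gamma(e)$, $T_t$ the subtree of nodes reachable from $t$, $\beta(T_t)=\bigcup_{t'\in V(T_t)}\beta(t')$; width $=\max_t|\Gamma(t)|-1$. An $\mathrm{SC}^\infty_\emptyset$-directed tree decomposition is an abstract digraph decomposition such that (1) $\{\beta(t)\}$ is a partition of $V(D)$ into possibly empty sets with nonempty root bag, and (2) for every $e=(s,t)\in E(T)$, $\beta(T_t)$ is the vertex set of a strong component of $D-\gamma(e)$ (no bound on $|V(T)|$). -}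

module Defs where

open import Data.Nat using (ℕ; zero; suc; _≤_)
open import Data.Fin using (Fin; _≟_)
open import Data.Fin.Subset using (Subset; _∈_; _∉_; _∪_; ⋃; ∣_∣)
open import Data.Bool using (Bool; false; not; _∧_; _∨_)
open import Data.List using (List; map; filterᵇ; allFin)
open import Data.Product using (Σ; ∃; _×_; _,_)
open import Data.Sum using (_⊎_)
open import Function using (_⇔_)
open import Relation.Nullary using (¬_)
open import Relation.Nullary.Decidable using (⌊_⌋)
open import Relation.Binary.PropositionalEquality using (_≡_; _≢_)

-- Finite simple digraphs: vertex set Fin n, arcs given by a Boolean
-- adjacency relation (so no parallel arcs), without loops.

record Digraph : Set where
  field
    n        : ℕ
    adj      : Fin n → Fin n → Bool
    loopless : ∀ v → adj v v ≡ false
open Digraph public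

-- Directed walks in D - X : all vertices used lie outside X.
data Reach (D : Digraph) (X : Subset (n D)) : Fin (n D) → Fin (n D) → Set where
  here : ∀ {u} → u ∉ X → Reach D X u u
  step : ∀ {u w v} → u ∉ X → adj D u w ≡ Data.Bool.true → Reach D X w v → Reach D X u v

-- S (a predicate on V(D)) is the vertex set of a strong component of D - X:
-- the equivalence class (under mutual reachability in D - X) of some vertex of D - X.
IsStrongComponent : (D : Digraph) → Subset (n D) → (Fin (n D) → Set) → Set
IsStrongComponent D X S =
  Σ (Fin (n D)) λ u → u ∉ X × S u ×
    (∀ v → S v ⇔ (v ∉ X × Reach D X u v × Reach D X v u))

-- Finite rooted directed trees via parent pointers.
-- The tree edges are exactly (parent t , t) for t ≢ root; such an edge is
-- identified with its head t.

iter : ∀ {A : Set} → (A → A) → ℕ → A → A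
iter f zero    a = a
iter f (suc k) a = f (iter f k a)

-- Abstract digraph decomposition (T, β, γ) of D.  γ is indexed by the
-- head of the edge; the value γ root is meaningless (no edge) and is never used.
record Decomposition (D : Digraph) : Set where
  field
    N         : ℕ
    root      : Fin N
    parent    : Fin N → Fin N
    parent-root : parent root ≡ root
    toRoot    : ∀ t → ∃ λ k → iter parent k t ≡ root
    β         : Fin N → Subset (n D)
    γ         : Fin N → Subset (n D)
open Decomposition public

module _ {D : Digraph} (T : Decomposition D) where

  InSubtree : Fin (N T) → Fin (N T) → Set
  InSubtree t t' = ∃ λ k → iter (parent T) k t' ≡ t

  βSub : Fin (N T) → Fin (n D) → Set
  βSub t v = ∃ λ t' → InSubtree t t' × v ∈ β T t'

  incident : Fin (N T) → List (Fin (N T))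
  incident t = filterᵇ
    (λ e → not ⌊ e ≟ root T ⌋ ∧ (⌊ e ≟ t ⌋ ∨ ⌊ parent T e ≟ t ⌋))
    (allFin (N T))

  Γ : Fin (N T) → Subset (n D)
  Γ t = β T t ∪ ⋃ (map (γ T) (incident t))

  -- width ≤ k  :  max_t |Γ(t)| - 1 ≤ k
  WidthAtMost : ℕ → Set
  WidthAtMost k = ∀ t → ∣ Γ t ∣ ≤ suc k

  WidthEq : ℕ → Set
  WidthEq k = WidthAtMost k × ∃ λ t → ∣ Γ t ∣ ≡ suc k

  IsSCDTD : Set
  IsSCDTD =
    (∀ v → ∃ λ t → v ∈ β T t) ×
    (∀ v t t' → v ∈ β T t → v ∈ β T t' → t ≡ t') ×
    (∃ λ v → v ∈ β T (root T)) ×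
    (∀ t → t ≢ root T → IsStrongComponent D (γ T t) (βSub t))

  SmallBags : Set
  SmallBags = ∀ t → ∣ β T t ∣ ≤ 1

-- Each bag is split into singleton nodes.  For a vertex v of a bag β(t), let
-- Comp v be the strong component of v in D minus γ(t) and the vertices of β(t)
-- smaller than v.  These components and the sets β(T_t) form a laminar family,
-- and the new tree is its inclusion order: v hangs below the greatest vertex of
-- its bag whose component contains v, or below t itself.  Every new separator
-- lies in the old Γ(t), so the width does not increase.

module Submission where

open import Defs
open import Data.Nat as ℕ using (ℕ; zero; suc; _+_; _*_; _∸_; z≤n; s≤s)
import Data.Nat.Properties as ℕP
open import Data.Fin using (Fin; zero; suc; _≟_; toℕ)
import Data.Fin.Properties as FP
open import Data.Fin.Subset using (Subset; _∈_; _∉_; _∪_; ⋃; ∣_∣; ⊥; ⁅_⁆; _⊆_)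
open import Data.Fin.Subset.Properties
  using (x∈p∪q⁻; x∈p∪q⁺; p⊆p∪q; x∈⁅x⁆; x∈⁅y⁆⇒x≡y; ∉⊥; p⊆q⇒∣p∣≤∣q∣; p⊂q⇒∣p∣<∣q∣; ∣p∣≤n; ∣p∣≡n⇒p≡⊤; ∈⊤; _∈?_; ∣⊥∣≡0; ∣⁅x⁆∣≡1)
open import Data.Bool using (Bool; true; false; not; _∧_; _∨_) renaming (_≟_ to _≟ᵇ_)
open import Data.Product using (Σ; ∃; _×_; _,_; proj₁; proj₂)
open import Data.Sum using (_⊎_; inj₁; inj₂)
open import Data.Sum.Properties using (inj₁-injective; inj₂-injective; ≡-dec)
open import Data.Empty using (⊥-elim)
open import Data.List using ([]; _∷_; map; filterᵇ; allFin)
open import Data.List.Membership.Propositional.Properties using (∈-allFin)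
open import Data.List.Relation.Unary.Any using (Any; here; there)
open import Data.Vec using (tabulate)
import Data.Vec.Properties as VecP
open import Relation.Nullary using (¬_; Dec; yes; no; _×-dec_; ¬?)
open import Relation.Nullary.Decidable using (⌊_⌋)
open import Relation.Binary.Definitions using (tri<; tri≈; tri>)
open import Relation.Binary.PropositionalEquality
  using (_≡_; _≢_; refl; sym; trans; cong; subst; module ≡-Reasoning)
open import Function using (_⇔_; mk⇔; _∘_)
open import Function.Bundles using (Equivalence; Inverse; _↔_)
import Function.Properties.Equivalence as ⇔

module _ {A : Set} (f : A → A) where

  iter-suc : ∀ k a → iter f (suc k) a ≡ iter f k (f a)
  iter-suc zero    a = refl
  iter-suc (suc k) a = cong f (iter-suc k a)

  iter-+ : ∀ i j a → iter f (i + j) a ≡ iter f i (iter f j a)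
  iter-+ zero    j a = refl
  iter-+ (suc i) j a = cong f (iter-+ i j a)

  iter-fixed : ∀ {r} → f r ≡ r → ∀ k → iter f k r ≡ r
  iter-fixed fr zero    = refl
  iter-fixed fr (suc k) = trans (cong f (iter-fixed fr k)) fr

  iter-periodic : ∀ {c} j → iter f (suc j) c ≡ c → ∀ q → iter f (q * suc j) c ≡ c
  iter-periodic j per zero    = refl
  iter-periodic {c} j per (suc q) = begin
    iter f (suc j + q * suc j) c          ≡⟨ iter-+ (suc j) (q * suc j) c ⟩
    iter f (suc j) (iter f (q * suc j) c) ≡⟨ cong (iter f (suc j)) (iter-periodic j per q) ⟩
    iter f (suc j) c                      ≡⟨ per ⟩
    c                                     ∎
    where open ≡-Reasoning

  periodic⇒≡fixed : ∀ {r c} → f r ≡ r → ∀ k → iter f k c ≡ r → ∀ j → iter f (suc j) c ≡ c → c ≡ r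
  periodic⇒≡fixed {r} {c} fr k reach j per = begin
    c                           ≡⟨ sym (iter-periodic j per k) ⟩
    iter f (k * suc j) c        ≡⟨ cong (λ i → iter f i c) (trans (ℕP.*-suc k j) (ℕP.+-comm k (k * j))) ⟩
    iter f (k * j + k) c        ≡⟨ iter-+ (k * j) k c ⟩
    iter f (k * j) (iter f k c) ≡⟨ cong (iter f (k * j)) reach ⟩
    iter f (k * j) r            ≡⟨ iter-fixed fr (k * j) ⟩
    r                           ∎
    where open ≡-Reasoning

∉-∪ : ∀ {n} {x : Fin n} {p q : Subset n} → x ∉ p → x ∉ q → x ∉ p ∪ q
∉-∪ {p = p} {q} x∉p x∉q x∈p∪q with x∈p∪q⁻ p q x∈p∪q
... | inj₁ x∈p = x∉p x∈p
... | inj₂ x∈q = x∉q x∈q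

subsetOf : ∀ {n} {P : Fin n → Set} → (∀ x → Dec (P x)) → Subset n
subsetOf P? = tabulate (λ x → ⌊ P? x ⌋)

module _ {n} {P : Fin n → Set} (P? : ∀ x → Dec (P x)) where

  ∈subsetOf⁻ : ∀ {x} → x ∈ subsetOf P? → P x
  ∈subsetOf⁻ {x} x∈ with P? x | trans (sym (VecP.lookup∘tabulate (λ y → ⌊ P? y ⌋) x)) (VecP.[]=⇒lookup x∈)
  ... | yes p | _  = p
  ... | no _  | ()

  ∈subsetOf⁺ : ∀ {x} → P x → x ∈ subsetOf P?
  ∈subsetOf⁺ {x} p = VecP.lookup⇒[]= x _ (trans (VecP.lookup∘tabulate (λ y → ⌊ P? y ⌋) x) (decided p (P? x)))
    where
    decided : P x → (d : Dec (P x)) → ⌊ d ⌋ ≡ true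
    decided _ (yes _) = refl
    decided p (no ¬p) = ⊥-elim (¬p p)

-- Reachability and strong components

module Reachability (D : Digraph) where

  V : Set
  V = Fin (n D)

  Reach-source∉ : ∀ {X u v} → Reach D X u v → u ∉ X
  Reach-source∉ (here u∉X)     = u∉X
  Reach-source∉ (step u∉X _ _) = u∉X

  Reach-target∉ : ∀ {X u v} → Reach D X u v → v ∉ X
  Reach-target∉ (here v∉X)   = v∉X
  Reach-target∉ (step _ _ r) = Reach-target∉ r

  Reach-trans : ∀ {X u w v} → Reach D X u w → Reach D X w v → Reach D X u v
  Reach-trans (here _)       r' = r'
  Reach-trans (step u∉X a r) r' = step u∉X a (Reach-trans r r')

  Reach-antimono : ∀ {X X' u v} → X ⊆ X' → Reach D X' u v → Reach D X u v
  Reach-antimono X⊆X' (here v∉X')     = here (v∉X' ∘ X⊆X')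
  Reach-antimono X⊆X' (step u∉X' a r) = step (u∉X' ∘ X⊆X') a (Reach-antimono X⊆X' r)

  data WalkIn (P : V → Set) : V → V → Set where
    here : ∀ {u} → P u → WalkIn P u u
    step : ∀ {u w v} → P u → adj D u w ≡ true → WalkIn P w v → WalkIn P u v

  WalkIn⇒Reach : ∀ {P X u v} → (∀ y → P y → y ∉ X) → WalkIn P u v → Reach D X u v
  WalkIn⇒Reach P∩X≡∅ (here pu)       = here (P∩X≡∅ _ pu)
  WalkIn⇒Reach P∩X≡∅ (step pu a w)   = step (P∩X≡∅ _ pu) a (WalkIn⇒Reach P∩X≡∅ w)

  ComponentOf : Subset (n D) → V → (V → Set) → Set
  ComponentOf X u S = ∀ v → S v ⇔ (v ∉ X × Reach D X u v × Reach D X v u)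

  module _ {X u S} (comp : ComponentOf X u S) where

    component⁺ : ∀ {v} → v ∉ X → Reach D X u v → Reach D X v u → S v
    component⁺ v∉X uv vu = Equivalence.from (comp _) (v∉X , uv , vu)

    component⁻ : ∀ {v} → S v → v ∉ X × Reach D X u v × Reach D X v u
    component⁻ s = Equivalence.to (comp _) s

    component-avoids : ∀ {v} → S v → v ∉ X
    component-avoids = proj₁ ∘ component⁻

    private
      walkInside : ∀ {a y} → Reach D X a y → Reach D X u a → Reach D X y u → WalkIn S a y
      walkInside (here a∉X)     ua yu = here (component⁺ a∉X ua yu)
      walkInside (step a∉X e r) ua yu =
        step (component⁺ a∉X ua (step a∉X e (Reach-trans r yu))) e
             (walkInside r (Reach-trans ua (step (Reach-target∉ ua) e (here (Reach-source∉ r)))) yu)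

    component-walk : ∀ {x y} → S x → S y → WalkIn S x y
    component-walk sx sy with component⁻ sx | component⁻ sy
    ... | _ , ux , xu | _ , uy , yu = walkInside (Reach-trans xu uy) ux yu

  private
    ∉-∪⁅⁆ : ∀ {X : Subset (n D)} {y u} → y ∉ X → y ≢ u → y ∉ X ∪ ⁅ u ⁆
    ∉-∪⁅⁆ y∉X y≢u = ∉-∪ y∉X (y≢u ∘ x∈⁅y⁆⇒x≡y _)

    avoidOrLeave : ∀ {X a v} u → Reach D X a v → u ≢ v →
                   Reach D (X ∪ ⁅ u ⁆) a v ⊎ ∃ λ w → adj D u w ≡ true × Reach D (X ∪ ⁅ u ⁆) w v
    avoidOrLeave u (here v∉X) u≢v = inj₁ (here (∉-∪⁅⁆ v∉X (u≢v ∘ sym)))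
    avoidOrLeave {a = a} u (step {w = w} a∉X e r) u≢v with avoidOrLeave u r u≢v
    ... | inj₂ leave = inj₂ leave
    ... | inj₁ r' with a ≟ u
    ...   | yes refl = inj₂ (w , e , r')
    ...   | no a≢u   = inj₁ (step (∉-∪⁅⁆ a∉X a≢u) e r')

  Reach-leave : ∀ {X u v} → Reach D X u v → u ≢ v →
                ∃ λ w → adj D u w ≡ true × Reach D (X ∪ ⁅ u ⁆) w v
  Reach-leave {u = u} r u≢v with avoidOrLeave u r u≢v
  ... | inj₂ leave = leave
  ... | inj₁ r'    = ⊥-elim (Reach-source∉ r' (x∈p∪q⁺ (inj₂ (x∈⁅x⁆ u))))

  -- Depth-first search; every recursive call removes one more vertex, so
  -- fuel f with n ≤ f + |X| suffices.
  private
    reach?-fuel : ∀ f (X : Subset (n D)) → n D ℕ.≤ f + ∣ X ∣ → ∀ u v → Dec (Reach D X u v)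
    reach?-fuel f X bound u v with u ∈? X
    ... | yes u∈X = no (λ r → Reach-source∉ r u∈X)
    ... | no u∉X with u ≟ v
    ...   | yes refl = yes (here u∉X)
    ...   | no u≢v with f
    ...     | zero = ⊥-elim (u∉X (subst (u ∈_) (sym (∣p∣≡n⇒p≡⊤ (ℕP.≤-antisym (∣p∣≤n X) bound))) ∈⊤))
    ...     | suc f with FP.any? (λ w → adj D u w ≟ᵇ true ×-dec reach?-fuel f (X ∪ ⁅ u ⁆) bound' w v)
      where
      grows : ∣ X ∣ ℕ.< ∣ X ∪ ⁅ u ⁆ ∣
      grows = p⊂q⇒∣p∣<∣q∣ (p⊆p∪q _ , u , x∈p∪q⁺ (inj₂ (x∈⁅x⁆ u)) , u∉X)
      bound' : n D ℕ.≤ f + ∣ X ∪ ⁅ u ⁆ ∣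
      bound' = ℕP.≤-trans bound (ℕP.≤-trans (ℕP.≤-reflexive (sym (ℕP.+-suc f ∣ X ∣))) (ℕP.+-monoʳ-≤ f grows))
    ...       | yes (w , e , r) = yes (step u∉X e (Reach-antimono (p⊆p∪q _) r))
    ...       | no ¬leave       = no (λ r → ¬leave (Reach-leave r u≢v))

  Reach? : ∀ X u v → Dec (Reach D X u v)
  Reach? X = reach?-fuel (n D) X (ℕP.m≤m+n (n D) ∣ X ∣)

module _ {A : Set} {m : ℕ} (f : A → Subset m) (p : A → Bool) where

  ∈⋃-filterᵇ⁻ : ∀ xs {x} → x ∈ ⋃ (map f (filterᵇ p xs)) → ∃ λ a → p a ≡ true × x ∈ f a
  ∈⋃-filterᵇ⁻ []       x∈ = ⊥-elim (∉⊥ x∈)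
  ∈⋃-filterᵇ⁻ (a ∷ xs) x∈ with p a in pa
  ... | false = ∈⋃-filterᵇ⁻ xs x∈
  ... | true with x∈p∪q⁻ (f a) _ x∈
  ...   | inj₁ x∈fa = a , pa , x∈fa
  ...   | inj₂ x∈′  = ∈⋃-filterᵇ⁻ xs x∈′

  ∈⋃-filterᵇ⁺ : ∀ xs {x a} → Any (a ≡_) xs → p a ≡ true → x ∈ f a → x ∈ ⋃ (map f (filterᵇ p xs))
  ∈⋃-filterᵇ⁺ (b ∷ xs) (here refl) pa x∈ rewrite pa = x∈p∪q⁺ (inj₁ x∈)
  ∈⋃-filterᵇ⁺ (b ∷ xs) (there a∈) pa x∈ with p b
  ... | false = ∈⋃-filterᵇ⁺ xs a∈ pa x∈
  ... | true  = x∈p∪q⁺ (inj₂ (∈⋃-filterᵇ⁺ xs a∈ pa x∈))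

module _ {D : Digraph} (T : Decomposition D) where

  IncidentTo : Fin (N T) → Fin (N T) → Set
  IncidentTo t e = e ≢ root T × (e ≡ t ⊎ parent T e ≡ t)

  private
    isIncident : Fin (N T) → Fin (N T) → Bool
    isIncident t e = not ⌊ e ≟ root T ⌋ ∧ (⌊ e ≟ t ⌋ ∨ ⌊ parent T e ≟ t ⌋)

    isIncident⁻ : ∀ t e → isIncident t e ≡ true → IncidentTo t e
    isIncident⁻ t e h with e ≟ root T | e ≟ t | parent T e ≟ t
    isIncident⁻ t e h  | no e≢r | yes e≡t | _      = e≢r , inj₁ e≡t
    isIncident⁻ t e h  | no e≢r | no _    | yes pe = e≢r , inj₂ pe
    isIncident⁻ t e () | no _   | no _    | no _
    isIncident⁻ t e () | yes _  | _       | _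

    isIncident⁺ : ∀ t e → IncidentTo t e → isIncident t e ≡ true
    isIncident⁺ t e (e≢r , inc) with e ≟ root T | e ≟ t | parent T e ≟ t | inc
    ... | yes e≡r | _       | _      | _       = ⊥-elim (e≢r e≡r)
    ... | no _    | yes _   | _      | _       = refl
    ... | no _    | no _    | yes _  | _       = refl
    ... | no _    | no e≢t  | no _   | inj₁ e≡t = ⊥-elim (e≢t e≡t)
    ... | no _    | no _    | no pe≢t | inj₂ pe = ⊥-elim (pe≢t pe)

  ∈Γ⁻ : ∀ t {x} → x ∈ Γ T t → x ∈ β T t ⊎ ∃ λ e → IncidentTo t e × x ∈ γ T e
  ∈Γ⁻ t x∈ with x∈p∪q⁻ (β T t) _ x∈
  ... | inj₁ x∈β = inj₁ x∈β
  ... | inj₂ x∈⋃ with ∈⋃-filterᵇ⁻ (γ T) (isIncident t) (allFin (N T)) x∈⋃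
  ...   | e , inc , x∈γ = inj₂ (e , isIncident⁻ t e inc , x∈γ)

  β⊆Γ : ∀ t → β T t ⊆ Γ T t
  β⊆Γ t x∈ = x∈p∪q⁺ (inj₁ x∈)

  γ⊆Γ : ∀ t e → IncidentTo t e → γ T e ⊆ Γ T t
  γ⊆Γ t e inc x∈ = x∈p∪q⁺ (inj₂ (∈⋃-filterᵇ⁺ (γ T) (isIncident t) (allFin (N T)) (∈-allFin e) (isIncident⁺ t e inc) x∈))

-- Blueprints
--
-- A blueprint specifies, besides the tree and the bags, a predicate Sub z
-- meant to be β(T_z); the local conditions below force this, and Sub z is
-- required to be a strong component of D - γ(z).  The set frame z bounds Γ(z).

record Blueprint (D : Digraph) (k : ℕ) (I : Set) : Set₁ where
  field
    root        : I
    parent      : I → I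
    parent-root : parent root ≡ root
    toRoot      : ∀ z → ∃ λ j → iter parent j z ≡ root
    β γ         : I → Subset (n D)
    Sub         : I → Fin (n D) → Set
    small       : ∀ z → ∣ β z ∣ ℕ.≤ 1
    cover       : ∀ v → ∃ λ z → v ∈ β z
    bags-disjoint : ∀ v z z' → v ∈ β z → v ∈ β z' → z ≡ z'
    root-bag    : ∃ λ v → v ∈ β root
    β⊆Sub       : ∀ z v → v ∈ β z → Sub z v
    Sub-parent  : ∀ z v → z ≢ root → Sub z v → Sub (parent z) v
    parent-β∉Sub : ∀ z v → z ≢ root → v ∈ β (parent z) → ¬ Sub z v
    siblings-disjoint : ∀ y w v → y ≢ root → w ≢ root → parent y ≡ parent w → Sub y v → Sub w v → y ≡ w
    Sub-component : ∀ z → z ≢ root → IsStrongComponent D (γ z) (Sub z)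
    frame       : I → Subset (n D)
    frame-size  : ∀ z → ∣ frame z ∣ ℕ.≤ suc k
    β⊆frame     : ∀ z → β z ⊆ frame z
    γ⊆frame     : ∀ z → z ≢ root → γ z ⊆ frame z
    child-γ⊆frame : ∀ z e → e ≢ root → parent e ≡ z → γ e ⊆ frame z

IsStrongComponent-cong : ∀ {D X} {S S' : Fin (n D) → Set} → (∀ v → S v ⇔ S' v) →
                         IsStrongComponent D X S → IsStrongComponent D X S'
IsStrongComponent-cong S⇔S' (u , u∉X , su , comp) =
  u , u∉X , Equivalence.to (S⇔S' u) su ,
  λ v → mk⇔ (Equivalence.to (comp v) ∘ Equivalence.from (S⇔S' v)) (Equivalence.to (S⇔S' v) ∘ Equivalence.from (comp v))

module FromBlueprint {D : Digraph} {k M : ℕ} (B : Blueprint D k (Fin M)) where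
  open Blueprint B renaming (root to r; parent to par; parent-root to par-r; toRoot to toR; β to bag; γ to sep)

  decomposition : Decomposition D
  decomposition = record
    { N = M ; root = r ; parent = par ; parent-root = par-r ; toRoot = toR ; β = bag ; γ = sep }

  private
    Sub-parent′ : ∀ z v → Sub z v → Sub (par z) v
    Sub-parent′ z v s with z ≟ r
    ... | yes refl = subst (λ q → Sub q v) (sym par-r) s
    ... | no z≢r   = Sub-parent z v z≢r s

  Sub-ancestor : ∀ j z v → Sub z v → Sub (iter par j z) v
  Sub-ancestor zero    z v s = s
  Sub-ancestor (suc j) z v s = Sub-parent′ _ v (Sub-ancestor j z v s)

  -- If v ∈ β z and v ∈ Sub y, then y is an ancestor of z: walking down from
  -- the root along the ancestors of z, Sub cannot leave the path, since
  -- siblings are disjoint and a parent's bag is outside its children's Sub.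
  module _ {v z} (v∈βz : v ∈ bag z) where

    private
      descend : ∀ i y → y ≢ r → iter par i z ≡ par y → Sub y v → ∃ λ i' → iter par i' z ≡ y
      descend zero    y y≢r e s = ⊥-elim (parent-β∉Sub y v y≢r (subst (v ∈_) (cong bag e) v∈βz) s)
      descend (suc i) y y≢r e s with iter par i z ≟ r
      ... | yes zᵢ≡r = descend i y y≢r (trans zᵢ≡r (trans (sym par-r) (trans (cong par (sym zᵢ≡r)) e))) s
      ... | no zᵢ≢r  = i , sym (siblings-disjoint y (iter par i z) v y≢r zᵢ≢r (sym e) s
                                  (Sub-ancestor i z v (β⊆Sub z v v∈βz)))

    Sub⇒ancestor : ∀ j y → iter par j y ≡ r → Sub y v → ∃ λ i → iter par i z ≡ y
    Sub⇒ancestor j y e s with y ≟ r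
    ... | yes refl = toR z
    Sub⇒ancestor zero    y e s | no y≢r = ⊥-elim (y≢r e)
    Sub⇒ancestor (suc j) y e s | no y≢r
      with Sub⇒ancestor j (par y) (trans (sym (iter-suc par j y)) e) (Sub-parent y v y≢r s)
    ... | i , eᵢ = descend i y y≢r eᵢ s

  βSub⇔Sub : ∀ t v → βSub decomposition t v ⇔ Sub t v
  βSub⇔Sub t v = mk⇔
    (λ { (t' , (j , e) , v∈) → subst (λ q → Sub q v) e (Sub-ancestor j t' v (β⊆Sub t' v v∈)) })
    (λ s → let (z , v∈βz) = cover v ; (j , e) = toR t in z , Sub⇒ancestor v∈βz j t e s , v∈βz)

  Γ⊆frame : ∀ t → Γ decomposition t ⊆ frame t
  Γ⊆frame t x∈ with ∈Γ⁻ decomposition t x∈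
  ... | inj₁ x∈β = β⊆frame t x∈β
  ... | inj₂ (e , (e≢r , inj₁ refl) , x∈γ) = γ⊆frame e e≢r x∈γ
  ... | inj₂ (e , (e≢r , inj₂ pe) , x∈γ)   = child-γ⊆frame t e e≢r pe x∈γ

  isSCDTD : IsSCDTD decomposition
  isSCDTD = cover , bags-disjoint , root-bag ,
    λ t t≢r → IsStrongComponent-cong (λ v → ⇔.sym (βSub⇔Sub t v)) (Sub-component t t≢r)

  width≤ : WidthAtMost decomposition k
  width≤ t = ℕP.≤-trans (p⊆q⇒∣p∣≤∣q∣ (Γ⊆frame t)) (frame-size t)

  result : Σ (Decomposition D) λ T' → IsSCDTD T' × WidthAtMost T' k × SmallBags T'
  result = decomposition , isSCDTD , width≤ , small

reindex : ∀ {D k I J} → J ↔ I → Blueprint D k I → Blueprint D k J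
reindex {D} {k} {I} {J} J↔I B = record
  { root = toJ r
  ; parent = par′
  ; parent-root = trans (cong (toJ ∘ par) (toI∘toJ r)) (cong toJ par-r)
  ; toRoot = λ z → let (j , e) = toR (toI z) in
      j , trans (cong (iter par′ j) (sym (toJ∘toI z))) (trans (iter-conj j (toI z)) (cong toJ e))
  ; β = bag ∘ toI
  ; γ = sep ∘ toI
  ; Sub = Sub ∘ toI
  ; small = small ∘ toI
  ; cover = λ v → let (z , v∈) = cover v in toJ z , subst (λ q → v ∈ bag q) (sym (toI∘toJ z)) v∈
  ; bags-disjoint = λ v z z' a b → toI-injective (bags-disjoint v _ _ a b)
  ; root-bag = let (v , v∈) = root-bag in v , subst (λ q → v ∈ bag q) (sym (toI∘toJ r)) v∈
  ; β⊆Sub = β⊆Sub ∘ toI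
  ; Sub-parent = λ z v z≢r s → subst (λ q → Sub q v) (sym (toI-par z)) (Sub-parent (toI z) v (toI≢r z≢r) s)
  ; parent-β∉Sub = λ z v z≢r v∈ → parent-β∉Sub (toI z) v (toI≢r z≢r) (subst (λ q → v ∈ bag q) (toI-par z) v∈)
  ; siblings-disjoint = λ y w v y≢r w≢r e sy sw → toI-injective (siblings-disjoint (toI y) (toI w) v
      (toI≢r y≢r) (toI≢r w≢r) (trans (sym (toI-par y)) (trans (cong toI e) (toI-par w))) sy sw)
  ; Sub-component = λ z z≢r → Sub-component (toI z) (toI≢r z≢r)
  ; frame = frame ∘ toI
  ; frame-size = frame-size ∘ toI
  ; β⊆frame = β⊆frame ∘ toI
  ; γ⊆frame = λ z z≢r → γ⊆frame (toI z) (toI≢r z≢r)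
  ; child-γ⊆frame = λ z e e≢r pe → child-γ⊆frame (toI z) (toI e) (toI≢r e≢r) (trans (sym (toI-par e)) (cong toI pe))
  }
  where
  open Inverse J↔I renaming (to to toI; from to toJ; strictlyInverseˡ to toI∘toJ; strictlyInverseʳ to toJ∘toI)
  open Blueprint B renaming (root to r; parent to par; parent-root to par-r; toRoot to toR; β to bag; γ to sep)

  par′ : J → J
  par′ = toJ ∘ par ∘ toI

  toI-par : ∀ z → toI (par′ z) ≡ par (toI z)
  toI-par z = toI∘toJ _

  iter-conj : ∀ j i → iter par′ j (toJ i) ≡ toJ (iter par j i)
  iter-conj zero    i = refl
  iter-conj (suc j) i = trans (cong par′ (iter-conj j i)) (cong (toJ ∘ par) (toI∘toJ _))

  toI≢r : ∀ {z} → z ≢ toJ r → toI z ≢ r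
  toI≢r {z} z≢r e = z≢r (trans (sym (toJ∘toI z)) (cong toJ e))

  toI-injective : ∀ {y w} → toI y ≡ toI w → y ≡ w
  toI-injective {y} {w} e = trans (sym (toJ∘toI y)) (trans (cong toJ e) (toJ∘toI w))

-- A blueprint with one unused node: the spare node has an empty bag and no
-- children, and nothing is required of it.

record SpareBlueprint (D : Digraph) (k : ℕ) (I : Set) : Set₁ where
  field
    _≟ᴵ_        : ∀ (a b : I) → Dec (a ≡ b)
    root        : I
    parent      : I → I
    parent-root : parent root ≡ root
    spare anchor : I
    root≢spare  : root ≢ spare
    anchor≢root : anchor ≢ root
    anchor≢spare : anchor ≢ spare
    parent≢spare : ∀ z → z ≢ spare → parent z ≢ spare
    toRoot      : ∀ z → z ≢ spare → ∃ λ j → iter parent j z ≡ root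
    β γ         : I → Subset (n D)
    spare-bag   : ∀ v → v ∉ β spare
    Sub         : I → Fin (n D) → Set
    small       : ∀ z → ∣ β z ∣ ℕ.≤ 1
    cover       : ∀ v → ∃ λ z → v ∈ β z
    bags-disjoint : ∀ v z z' → v ∈ β z → v ∈ β z' → z ≡ z'
    root-bag    : ∃ λ v → v ∈ β root
    β⊆Sub       : ∀ z v → z ≢ spare → v ∈ β z → Sub z v
    Sub-parent  : ∀ z v → z ≢ spare → z ≢ root → Sub z v → Sub (parent z) v
    parent-β∉Sub : ∀ z v → z ≢ spare → z ≢ root → v ∈ β (parent z) → ¬ Sub z v
    siblings-disjoint : ∀ y w v → y ≢ spare → w ≢ spare → y ≢ root → w ≢ root →
                        parent y ≡ parent w → Sub y v → Sub w v → y ≡ w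
    Sub-component : ∀ z → z ≢ spare → z ≢ root → IsStrongComponent D (γ z) (Sub z)
    frame       : I → Subset (n D)
    frame-size  : ∀ z → z ≢ spare → ∣ frame z ∣ ℕ.≤ suc k
    β⊆frame     : ∀ z → z ≢ spare → β z ⊆ frame z
    γ⊆frame     : ∀ z → z ≢ spare → z ≢ root → γ z ⊆ frame z
    child-γ⊆frame : ∀ z e → z ≢ spare → e ≢ spare → e ≢ root → parent e ≡ z → γ e ⊆ frame z

-- The spare node is used to subdivide the edge above the anchor; it copies
-- γ, Sub and frame from the anchor.
module AbsorbSpare {D : Digraph} {k : ℕ} {I : Set} (B : SpareBlueprint D k I) where
  open SpareBlueprint B renaming (root to r; parent to par; parent-root to par-r; toRoot to toR; β to bag; γ to sep)

  redirect : I → I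
  redirect z with z ≟ᴵ spare
  ... | yes _ = anchor
  ... | no _  = z

  redirect-spare : redirect spare ≡ anchor
  redirect-spare with spare ≟ᴵ spare
  ... | yes _ = refl
  ... | no ≢  = ⊥-elim (≢ refl)

  redirect-other : ∀ {z} → z ≢ spare → redirect z ≡ z
  redirect-other {z} z≢g with z ≟ᴵ spare
  ... | yes z≡g = ⊥-elim (z≢g z≡g)
  ... | no _    = refl

  redirect≢spare : ∀ z → redirect z ≢ spare
  redirect≢spare z with z ≟ᴵ spare
  ... | yes _   = anchor≢spare
  ... | no z≢g  = z≢g

  redirect≢root : ∀ {z} → z ≢ r → redirect z ≢ r
  redirect≢root {z} z≢r with z ≟ᴵ spare
  ... | yes _ = anchor≢root
  ... | no _  = z≢r

  par′ : I → I
  par′ z with z ≟ᴵ anchor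
  ... | yes _ = spare
  ... | no _  = par (redirect z)

  par′-anchor : par′ anchor ≡ spare
  par′-anchor with anchor ≟ᴵ anchor
  ... | yes _ = refl
  ... | no ≢  = ⊥-elim (≢ refl)

  par′-other : ∀ {z} → z ≢ anchor → par′ z ≡ par (redirect z)
  par′-other {z} z≢a with z ≟ᴵ anchor
  ... | yes z≡a = ⊥-elim (z≢a z≡a)
  ... | no _    = refl

  redirect-par′ : ∀ {z} → z ≢ anchor → redirect (par′ z) ≡ par (redirect z)
  redirect-par′ {z} z≢a = trans (cong redirect (par′-other z≢a))
                                (redirect-other (parent≢spare _ (redirect≢spare z)))

  redirect-injective : ∀ {y w} → y ≢ anchor → w ≢ anchor → redirect y ≡ redirect w → y ≡ w
  redirect-injective {y} {w} y≢a w≢a e with y ≟ᴵ spare | w ≟ᴵ spare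
  ... | yes y≡g | yes w≡g = trans y≡g (sym w≡g)
  ... | yes _   | no _    = ⊥-elim (w≢a (sym e))
  ... | no _    | yes _   = ⊥-elim (y≢a e)
  ... | no _    | no _    = e

  anchor? : ∀ z → z ≡ anchor ⊎ z ≢ anchor
  anchor? z with z ≟ᴵ anchor
  ... | yes z≡a = inj₁ z≡a
  ... | no z≢a  = inj₂ z≢a

  r≢anchor : r ≢ anchor
  r≢anchor = anchor≢root ∘ sym

  par′-root : par′ r ≡ r
  par′-root = trans (par′-other r≢anchor) (trans (cong par (redirect-other root≢spare)) par-r)

  par′-spare : par′ spare ≡ par anchor
  par′-spare = trans (par′-other (anchor≢spare ∘ sym)) (cong par redirect-spare)

  toRoot′-other : ∀ j z → z ≢ spare → iter par j z ≡ r → ∃ λ i → iter par′ i z ≡ r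
  toRoot′-other zero    z z≢g e = zero , e
  toRoot′-other (suc j) z z≢g e with anchor? z
  ... | inj₁ refl =
    let (i , h) = toRoot′-other j (par anchor) (parent≢spare anchor anchor≢spare) (trans (sym (iter-suc par j anchor)) e)
    in suc (suc i) , trans (iter-suc par′ (suc i) anchor) (trans (cong (iter par′ (suc i)) par′-anchor)
         (trans (iter-suc par′ i spare) (trans (cong (iter par′ i) par′-spare) h)))
  ... | inj₂ z≢a =
    let (i , h) = toRoot′-other j (par z) (parent≢spare z z≢g) (trans (sym (iter-suc par j z)) e)
    in suc i , trans (iter-suc par′ i z)
         (trans (cong (iter par′ i) (trans (par′-other z≢a) (cong par (redirect-other z≢g)))) h)

  toRoot′ : ∀ z → ∃ λ i → iter par′ i z ≡ r
  toRoot′ z with z ≟ᴵ spare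
  ... | no z≢g = let (j , e) = toR z z≢g in toRoot′-other j z z≢g e
  ... | yes refl with toR anchor anchor≢spare
  ...   | zero , e  = ⊥-elim (anchor≢root e)
  ...   | suc j , e =
    let (i , h) = toRoot′-other j (par anchor) (parent≢spare anchor anchor≢spare) (trans (sym (iter-suc par j anchor)) e)
    in suc i , trans (iter-suc par′ i spare) (trans (cong (iter par′ i) par′-spare) h)

  β⊆Sub′ : ∀ z v → v ∈ bag z → Sub (redirect z) v
  β⊆Sub′ z v v∈ with z ≟ᴵ spare
  ... | yes refl = ⊥-elim (spare-bag v v∈)
  ... | no z≢g   = β⊆Sub z v z≢g v∈

  Sub-parent′ : ∀ z v → z ≢ r → Sub (redirect z) v → Sub (redirect (par′ z)) v
  Sub-parent′ z v z≢r s with anchor? z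
  ... | inj₁ refl = subst (λ q → Sub (redirect q) v) (sym par′-anchor)
                     (subst (λ q → Sub q v) (sym redirect-spare) (subst (λ q → Sub q v) (redirect-other anchor≢spare) s))
  ... | inj₂ z≢a   = subst (λ q → Sub q v) (sym (redirect-par′ z≢a))
                     (Sub-parent (redirect z) v (redirect≢spare z) (redirect≢root z≢r) s)

  parent-β∉Sub′ : ∀ z v → z ≢ r → v ∈ bag (par′ z) → ¬ Sub (redirect z) v
  parent-β∉Sub′ z v z≢r v∈ with anchor? z
  ... | inj₁ refl = λ _ → spare-bag v (subst (λ q → v ∈ bag q) par′-anchor v∈)
  ... | inj₂ z≢a   = parent-β∉Sub (redirect z) v (redirect≢spare z) (redirect≢root z≢r)
                     (subst (λ q → v ∈ bag q) (par′-other z≢a) v∈)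

  siblings-disjoint′ : ∀ y w v → y ≢ r → w ≢ r → par′ y ≡ par′ w →
                       Sub (redirect y) v → Sub (redirect w) v → y ≡ w
  siblings-disjoint′ y w v y≢r w≢r e sy sw with anchor? y | anchor? w
  ... | inj₁ refl | inj₁ refl = refl
  ... | inj₁ refl | inj₂ w≢a   = ⊥-elim (parent≢spare _ (redirect≢spare w) (trans (sym (par′-other w≢a)) (sym (trans (sym par′-anchor) e))))
  ... | inj₂ y≢a   | inj₁ refl = ⊥-elim (parent≢spare _ (redirect≢spare y) (trans (sym (par′-other y≢a)) (trans e par′-anchor)))
  ... | inj₂ y≢a   | inj₂ w≢a   = redirect-injective y≢a w≢a
    (siblings-disjoint (redirect y) (redirect w) v (redirect≢spare y) (redirect≢spare w)
       (redirect≢root y≢r) (redirect≢root w≢r) (trans (sym (par′-other y≢a)) (trans e (par′-other w≢a))) sy sw)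

  β⊆frame′ : ∀ z → bag z ⊆ frame (redirect z)
  β⊆frame′ z {v} v∈ with z ≟ᴵ spare
  ... | yes refl = ⊥-elim (spare-bag v v∈)
  ... | no z≢g   = β⊆frame z z≢g v∈

  child-γ⊆frame′ : ∀ z e → e ≢ r → par′ e ≡ z → sep (redirect e) ⊆ frame (redirect z)
  child-γ⊆frame′ z e e≢r refl {x} x∈ with anchor? e
  ... | inj₁ refl = subst (λ q → x ∈ frame (redirect q)) (sym par′-anchor)
                     (subst (λ q → x ∈ frame q) (sym redirect-spare)
                        (γ⊆frame anchor anchor≢spare anchor≢root (subst (λ q → x ∈ sep q) (redirect-other anchor≢spare) x∈)))
  ... | inj₂ e≢a   = subst (λ q → x ∈ frame q) (sym (redirect-par′ e≢a))
                     (child-γ⊆frame _ (redirect e) (parent≢spare _ (redirect≢spare e)) (redirect≢spare e)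
                        (redirect≢root e≢r) refl x∈)

  blueprint : Blueprint D k I
  blueprint = record
    { root = r ; parent = par′ ; parent-root = par′-root ; toRoot = toRoot′
    ; β = bag ; γ = sep ∘ redirect ; Sub = Sub ∘ redirect
    ; small = small ; cover = cover ; bags-disjoint = bags-disjoint ; root-bag = root-bag
    ; β⊆Sub = β⊆Sub′ ; Sub-parent = Sub-parent′ ; parent-β∉Sub = parent-β∉Sub′
    ; siblings-disjoint = siblings-disjoint′
    ; Sub-component = λ z z≢r → Sub-component (redirect z) (redirect≢spare z) (redirect≢root z≢r)
    ; frame = frame ∘ redirect
    ; frame-size = λ z → frame-size (redirect z) (redirect≢spare z)
    ; β⊆frame = β⊆frame′
    ; γ⊆frame = λ z z≢r → γ⊆frame (redirect z) (redirect≢spare z) (redirect≢root z≢r)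
    ; child-γ⊆frame = child-γ⊆frame′
    }

Greatest Least : ∀ {m} → (Fin m → Set) → Fin m → Set
Greatest Q w = Q w × ∀ w' → Q w' → toℕ w' ℕ.≤ toℕ w
Least    Q w = Q w × ∀ w' → Q w' → toℕ w ℕ.≤ toℕ w'

greatest? : ∀ {m} (Q : Fin m → Set) → (∀ w → Dec (Q w)) → ∃ (Greatest Q) ⊎ (∀ w → ¬ Q w)
greatest? {zero}  Q Q? = inj₂ (λ ())
greatest? {suc m} Q Q? with greatest? (Q ∘ suc) (Q? ∘ suc)
... | inj₁ (w , q , max) = inj₁ (suc w , q , λ { zero _ → z≤n ; (suc w') q' → s≤s (max w' q') })
... | inj₂ none with Q? zero
...   | yes q  = inj₁ (zero , q , λ { zero _ → z≤n ; (suc w') q' → ⊥-elim (none w' q') })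
...   | no ¬q  = inj₂ (λ { zero q → ¬q q ; (suc w') q → none w' q })

least? : ∀ {m} (Q : Fin m → Set) → (∀ w → Dec (Q w)) → ∃ (Least Q) ⊎ (∀ w → ¬ Q w)
least? {zero}  Q Q? = inj₂ (λ ())
least? {suc m} Q Q? with Q? zero
... | yes q = inj₁ (zero , q , λ _ _ → z≤n)
... | no ¬q with least? (Q ∘ suc) (Q? ∘ suc)
...   | inj₁ (w , q , min) = inj₁ (suc w , q , λ { zero q' → ⊥-elim (¬q q') ; (suc w') q' → s≤s (min w' q') })
...   | inj₂ none          = inj₂ (λ { zero q → ¬q q ; (suc w') q → none w' q })

module SubtreeFacts {D : Digraph} (T : Decomposition D) (sc : IsSCDTD T) where

  r : Fin (N T)
  r = root T

  par : Fin (N T) → Fin (N T)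
  par = parent T

  owner : Fin (n D) → Fin (N T)
  owner v = proj₁ (proj₁ sc v)

  ∈β-owner : ∀ v → v ∈ β T (owner v)
  ∈β-owner v = proj₂ (proj₁ sc v)

  owner-unique : ∀ {v t} → v ∈ β T t → owner v ≡ t
  owner-unique {v} v∈ = proj₁ (proj₂ sc) v _ _ (∈β-owner v) v∈

  βSub-root : ∀ x → βSub T r x
  βSub-root x = owner x , toRoot T (owner x) , ∈β-owner x

  βSub-parent : ∀ t x → βSub T t x → βSub T (par t) x
  βSub-parent t x (t' , (j , e) , x∈) = t' , (suc j , cong par e) , x∈

  β⊆βSub : ∀ t x → x ∈ β T t → βSub T t x
  β⊆βSub t x x∈ = t , (zero , refl) , x∈

  private
    parent-on-cycle⇒root : ∀ c j → iter par (suc j) (par c) ≡ par c → par c ≡ r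
    parent-on-cycle⇒root c j cyc =
      let (i , reach) = toRoot T (par c) in periodic⇒≡fixed par (parent-root T) i reach j cyc

    below-parent⇒root : ∀ c j → iter par j (par c) ≡ c → c ≡ r
    below-parent⇒root c j e = begin
      c                      ≡⟨ sym e ⟩
      iter par j (par c)     ≡⟨ cong (iter par j) (parent-on-cycle⇒root c j (cong par e)) ⟩
      iter par j r           ≡⟨ iter-fixed par (parent-root T) j ⟩
      r                      ∎
      where open ≡-Reasoning

  parent-β∉βSub : ∀ c x → c ≢ r → x ∈ β T (par c) → ¬ βSub T c x
  parent-β∉βSub c x c≢r x∈βpc (t' , (j , e) , x∈βt') with proj₁ (proj₂ sc) x t' (par c) x∈βt' x∈βpc
  ... | refl = c≢r (below-parent⇒root c j e)

  private
    descendant-sibling⇒≡ : ∀ d c c' → iter par d c ≡ c' → par c ≡ par c' → c' ≢ r → c ≡ c'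
    descendant-sibling⇒≡ zero    c c' e _  _    = e
    descendant-sibling⇒≡ (suc d) c c' e pe c'≢r =
      ⊥-elim (c'≢r (below-parent⇒root c' d (trans (cong (iter par d) (sym pe)) (trans (sym (iter-suc par d c)) e))))

    descend-from : ∀ {t a b y y'} → a ℕ.≤ b → iter par a t ≡ y → iter par b t ≡ y' → iter par (b ∸ a) y ≡ y'
    descend-from {t} {a} {b} {y} {y'} a≤b ea eb = begin
      iter par (b ∸ a) y                ≡⟨ cong (iter par (b ∸ a)) (sym ea) ⟩
      iter par (b ∸ a) (iter par a t)   ≡⟨ sym (iter-+ par (b ∸ a) a t) ⟩
      iter par (b ∸ a + a) t            ≡⟨ cong (λ i → iter par i t) (ℕP.m∸n+n≡m a≤b) ⟩
      iter par b t                      ≡⟨ eb ⟩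
      y'                                ∎
      where open ≡-Reasoning

  βSub-siblings-disjoint : ∀ c c' x → c ≢ r → c' ≢ r → par c ≡ par c' → βSub T c x → βSub T c' x → c ≡ c'
  βSub-siblings-disjoint c c' x c≢r c'≢r pe (t , (a , ea) , x∈) (t' , (b , eb) , x∈')
    with proj₁ (proj₂ sc) x t t' x∈ x∈'
  ... | refl with ℕP.≤-total a b
  ...   | inj₁ a≤b = descendant-sibling⇒≡ (b ∸ a) c c' (descend-from a≤b ea eb) pe c'≢r
  ...   | inj₂ b≤a = sym (descendant-sibling⇒≡ (a ∸ b) c' c (descend-from b≤a eb ea) (sym pe) c≢r)

-- Components of the bag vertices

module VertexComponents {D : Digraph} (T : Decomposition D) (sc : IsSCDTD T) where
  open SubtreeFacts T sc public
  open Reachability D public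

  leastRootVertex : ∃ (Least (_∈ β T r))
  leastRootVertex with least? (_∈ β T r) (_∈? β T r)
  ... | inj₁ least = least
  ... | inj₂ none  = ⊥-elim (none _ (proj₂ (proj₁ (proj₂ (proj₂ sc)))))

  m : V
  m = proj₁ leastRootVertex

  m∈β-root : m ∈ β T r
  m∈β-root = proj₁ (proj₂ leastRootVertex)

  m-least : ∀ w → w ∈ β T r → toℕ m ℕ.≤ toℕ w
  m-least = proj₂ (proj₂ leastRootVertex)

  -- repOf r is junk.
  repOf : Fin (N T) → V
  repOf c with c ≟ r
  ... | yes _ = m
  ... | no c≢r = proj₁ (proj₂ (proj₂ (proj₂ sc)) c c≢r)

  repOf-component : ∀ c → c ≢ r → βSub T c (repOf c) × ComponentOf (γ T c) (repOf c) (βSub T c)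
  repOf-component c c≢r with c ≟ r
  ... | yes c≡r  = ⊥-elim (c≢r c≡r)
  ... | no c≢r′ = let (_ , _ , s , comp) = proj₂ (proj₂ (proj₂ sc)) c c≢r′ in s , comp

  root? : ∀ t → t ≡ r ⊎ t ≢ r
  root? t with t ≟ r
  ... | yes t≡r = inj₁ t≡r
  ... | no t≢r  = inj₂ t≢r

  sep : Fin (N T) → Subset (n D)
  sep t with t ≟ r
  ... | yes _ = ⊥
  ... | no _  = γ T t

  γ⊆sep : ∀ {t} → t ≢ r → γ T t ⊆ sep t
  γ⊆sep {t} t≢r x∈ with t ≟ r
  ... | yes t≡r = ⊥-elim (t≢r t≡r)
  ... | no _    = x∈

  ∈sep⁻ : ∀ t {x} → x ∈ sep t → t ≢ r × x ∈ γ T t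
  ∈sep⁻ t x∈ with t ≟ r
  ... | yes _   = ⊥-elim (∉⊥ x∈)
  ... | no t≢r  = t≢r , x∈

  βSub-avoids-sep : ∀ t x → βSub T t x → x ∉ sep t
  βSub-avoids-sep t x s x∈ with t ≟ r
  ... | yes _   = ∉⊥ x∈
  ... | no t≢r  = component-avoids (proj₂ (repOf-component t t≢r)) s x∈

  EarlierIn : V → V → Set
  EarlierIn v w = w ∈ β T (owner v) × toℕ w ℕ.< toℕ v

  earlier : V → Subset (n D)
  earlier v = subsetOf (λ w → (w ∈? β T (owner v)) ×-dec (toℕ w ℕ.<? toℕ v))

  ∈earlier⁻ : ∀ {v w} → w ∈ earlier v → EarlierIn v w
  ∈earlier⁻ = ∈subsetOf⁻ _

  ∈earlier⁺ : ∀ {v w} → EarlierIn v w → w ∈ earlier v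
  ∈earlier⁺ = ∈subsetOf⁺ _

  vsep : V → Subset (n D)
  vsep v = sep (owner v) ∪ earlier v

  Comp : V → V → Set
  Comp v x = x ∉ vsep v × Reach D (vsep v) v x × Reach D (vsep v) x v

  Comp? : ∀ v x → Dec (Comp v x)
  Comp? v x = ¬? (x ∈? vsep v) ×-dec (Reach? (vsep v) v x ×-dec Reach? (vsep v) x v)

  Comp-component : ∀ v → ComponentOf (vsep v) v (Comp v)
  Comp-component v x = mk⇔ (λ c → c) (λ c → c)

  self∉vsep : ∀ v → v ∉ vsep v
  self∉vsep v = ∉-∪ (βSub-avoids-sep (owner v) v (β⊆βSub (owner v) v (∈β-owner v)))
                    (λ v∈ → ℕP.<-irrefl refl (proj₂ (∈earlier⁻ v∈)))

  Comp-self : ∀ v → Comp v v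
  Comp-self v = self∉vsep v , here (self∉vsep v) , here (self∉vsep v)

  Comp⊆βSub-owner : ∀ v x → Comp v x → βSub T (owner v) x
  Comp⊆βSub-owner v x (x∉ , vx , xv) with root? (owner v)
  ... | inj₁ o≡r = subst (λ q → βSub T q x) (sym o≡r) (βSub-root x)
  ... | inj₂ o≢r =
    let comp = proj₂ (repOf-component (owner v) o≢r)
        γ⊆vsep : γ T (owner v) ⊆ vsep v
        γ⊆vsep x∈ = x∈p∪q⁺ (inj₁ (γ⊆sep o≢r x∈))
        (_ , ρv , vρ) = component⁻ comp (β⊆βSub (owner v) v (∈β-owner v))
    in component⁺ comp (x∉ ∘ γ⊆vsep) (Reach-trans ρv (Reach-antimono γ⊆vsep vx))
                                      (Reach-trans (Reach-antimono γ⊆vsep xv) vρ)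

  -- The bag vertices before w are deleted in forming Comp w.
  Comp-bag⇒> : ∀ v w → v ∈ β T (owner w) → Comp w v → v ≢ w → toℕ w ℕ.< toℕ v
  Comp-bag⇒> v w v∈ cwv v≢w with ℕP.<-cmp (toℕ v) (toℕ w)
  ... | tri< v<w _ _ = ⊥-elim (proj₁ cwv (x∈p∪q⁺ (inj₂ (∈earlier⁺ (v∈ , v<w)))))
  ... | tri≈ _ v≡w _ = ⊥-elim (v≢w (FP.toℕ-injective v≡w))
  ... | tri> _ _ w<v = w<v

  vsep-mono : ∀ v w → owner v ≡ owner w → toℕ w ℕ.< toℕ v → vsep w ⊆ vsep v
  vsep-mono v w e w<v x∈ with x∈p∪q⁻ (sep (owner w)) (earlier w) x∈
  ... | inj₁ x∈sep = x∈p∪q⁺ (inj₁ (subst (λ q → _ ∈ sep q) (sym e) x∈sep))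
  ... | inj₂ x∈ear = let (x∈β , x<w) = ∈earlier⁻ x∈ear in
    x∈p∪q⁺ (inj₂ (∈earlier⁺ (subst (λ q → _ ∈ β T q) (sym e) x∈β , ℕP.<-trans x<w w<v)))

  Comp-nested : ∀ v w → owner v ≡ owner w → Comp w v → v ≢ w → ∀ x → Comp v x → Comp w x
  Comp-nested v w e cwv@(_ , wv , vw) v≢w x (x∉ , vx , xv) =
    let w<v = Comp-bag⇒> v w (subst (λ q → v ∈ β T q) e (∈β-owner v)) cwv v≢w
        mono = vsep-mono v w e w<v
    in x∉ ∘ mono , Reach-trans wv (Reach-antimono mono vx) , Reach-trans (Reach-antimono mono xv) vw

  Comp-overlap : ∀ v v' x → owner v ≡ owner v' → toℕ v ℕ.< toℕ v' → Comp v x → Comp v' x → Comp v v'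
  Comp-overlap v v' x e v<v' (_ , vx , xv) (_ , v'x , xv') =
    let mono = vsep-mono v' v (sym e) v<v'
    in self∉vsep v' ∘ mono , Reach-trans vx (Reach-antimono mono xv') , Reach-trans (Reach-antimono mono v'x) xv

  -- A strongly connected set avoiding vsep w and meeting Comp w lies in Comp w.
  βSub⊆Comp : ∀ c w x → c ≢ r → (∀ y → βSub T c y → y ∉ vsep w) → βSub T c x → Comp w x →
              ∀ y → βSub T c y → Comp w y
  βSub⊆Comp c w x c≢r avoid sx (_ , wx , xw) y sy =
    let comp = proj₂ (repOf-component c c≢r)
    in avoid y sy , Reach-trans wx (WalkIn⇒Reach avoid (component-walk comp sx sy))
                  , Reach-trans (WalkIn⇒Reach avoid (component-walk comp sy sx)) xw

  βSub-avoids-vsep : ∀ c w → c ≢ r → w ∈ β T (par c) → ∀ y → βSub T c y → y ∉ vsep w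
  βSub-avoids-vsep c w c≢r w∈ y sy =
    ∉-∪ (subst (λ q → y ∉ sep q) (sym (owner-unique w∈)) (βSub-avoids-sep (par c) y (βSub-parent c y sy)))
        (λ y∈ → parent-β∉βSub c y c≢r (subst (λ q → y ∈ β T q) (owner-unique w∈) (proj₁ (∈earlier⁻ y∈))) sy)

-- The refined decomposition
--
-- Nodes are the old nodes ("hubs") and the vertices.  A hub t ≠ r is hung like
-- a vertex, using a representative of β(T_t) in the bag of its parent.  The
-- root hub keeps m, so the vertex node of m is spare.

module Construction {D : Digraph} (T : Decomposition D) (k : ℕ) (sc : IsSCDTD T) (wd : WidthAtMost T k) where
  open VertexComponents T sc

  Node : Set
  Node = Fin (N T) ⊎ V

  Candidate : Fin (N T) → V → V → Set
  Candidate t x w = w ∈ β T t × w ≢ m × w ≢ x × Comp w x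

  Candidate? : ∀ t x w → Dec (Candidate t x w)
  Candidate? t x w = (w ∈? β T t) ×-dec (¬? (w ≟ m) ×-dec (¬? (w ≟ x) ×-dec Comp? w x))

  attach : Fin (N T) → V → Node
  attach t x with greatest? (Candidate t x) (Candidate? t x)
  ... | inj₁ (w , _) = inj₂ w
  ... | inj₂ _       = inj₁ t

  data Attached (t : Fin (N T)) (x : V) : Node → Set where
    toHub    : (∀ w → ¬ Candidate t x w) → Attached t x (inj₁ t)
    toVertex : ∀ w → Greatest (Candidate t x) w → Attached t x (inj₂ w)

  attached : ∀ t x → Attached t x (attach t x)
  attached t x with greatest? (Candidate t x) (Candidate? t x)
  ... | inj₁ (w , greatest) = toVertex w greatest
  ... | inj₂ none           = toHub none

  hubParent : Fin (N T) → Node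
  hubParent t with root? t
  ... | inj₁ _ = inj₁ r
  ... | inj₂ _ = attach (par t) (repOf t)

  parent′ : Node → Node
  parent′ (inj₁ t) = hubParent t
  parent′ (inj₂ v) = attach (owner v) v

  parent′-hub : ∀ {t} → t ≢ r → parent′ (inj₁ t) ≡ attach (par t) (repOf t)
  parent′-hub {t} t≢r with root? t
  ... | inj₁ t≡r = ⊥-elim (t≢r t≡r)
  ... | inj₂ _   = refl

  bag′ : Node → Subset (n D)
  bag′ (inj₁ t) with t ≟ r
  ... | yes _ = ⁅ m ⁆
  ... | no _  = ⊥
  bag′ (inj₂ v) with v ≟ m
  ... | yes _ = ⊥
  ... | no _  = ⁅ v ⁆

  sep′ : Node → Subset (n D)
  sep′ (inj₁ t) = γ T t
  sep′ (inj₂ v) = vsep v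

  Sub′ : Node → V → Set
  Sub′ (inj₁ t) = βSub T t
  Sub′ (inj₂ v) = Comp v

  frame′ : Node → Subset (n D)
  frame′ (inj₁ t) = Γ T t
  frame′ (inj₂ v) = Γ T (owner v)

  spare : Node
  spare = inj₂ m

  ∈bag′⁻ : ∀ z x → x ∈ bag′ z → (z ≡ inj₁ r × x ≡ m) ⊎ (z ≡ inj₂ x × x ≢ m)
  ∈bag′⁻ (inj₁ t) x x∈ with t ≟ r
  ... | yes refl = inj₁ (refl , x∈⁅y⁆⇒x≡y m x∈)
  ... | no _     = ⊥-elim (∉⊥ x∈)
  ∈bag′⁻ (inj₂ v) x x∈ with v ≟ m
  ... | yes _ = ⊥-elim (∉⊥ x∈)
  ... | no v≢m with x∈⁅y⁆⇒x≡y v x∈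
  ...   | refl = inj₂ (refl , v≢m)

  m∈bag′-root : m ∈ bag′ (inj₁ r)
  m∈bag′-root with r ≟ r
  ... | yes _ = x∈⁅x⁆ m
  ... | no r≢r = ⊥-elim (r≢r refl)

  ∈bag′-vertex : ∀ {v} → v ≢ m → v ∈ bag′ (inj₂ v)
  ∈bag′-vertex {v} v≢m with v ≟ m
  ... | yes v≡m = ⊥-elim (v≢m v≡m)
  ... | no _    = x∈⁅x⁆ v

  small′ : ∀ z → ∣ bag′ z ∣ ℕ.≤ 1
  small′ (inj₁ t) with t ≟ r
  ... | yes _ = ℕP.≤-reflexive (∣⁅x⁆∣≡1 m)
  ... | no _  = ℕP.≤-trans (ℕP.≤-reflexive (∣⊥∣≡0 (n D))) z≤n
  small′ (inj₂ v) with v ≟ m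
  ... | yes _ = ℕP.≤-trans (ℕP.≤-reflexive (∣⊥∣≡0 (n D))) z≤n
  ... | no _  = ℕP.≤-reflexive (∣⁅x⁆∣≡1 v)

  candidate-owner : ∀ {t x w} → Candidate t x w → owner w ≡ t
  candidate-owner (w∈ , _) = owner-unique w∈

  -- hence climbing from a vertex node terminates
  candidate-< : ∀ {v w} → Candidate (owner v) v w → toℕ w ℕ.< toℕ v
  candidate-< {v} cand@(_ , _ , w≢v , cwv) =
    Comp-bag⇒> v _ (subst (λ q → v ∈ β T q) (sym (candidate-owner cand)) (∈β-owner v)) cwv (w≢v ∘ sym)

  attach≢spare : ∀ t x → attach t x ≢ spare
  attach≢spare t x = helper _ (attached t x)
    where
    helper : ∀ z → Attached t x z → z ≢ spare
    helper _ (toVertex w (cand , _)) e = proj₁ (proj₂ cand) (inj₂-injective e)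

  parent′≢spare : ∀ z → parent′ z ≢ spare
  parent′≢spare (inj₁ t) with root? t
  ... | inj₁ _ = λ ()
  ... | inj₂ _ = attach≢spare (par t) (repOf t)
  parent′≢spare (inj₂ v) = attach≢spare (owner v) v

  private
    climb-fuel : ∀ f v → toℕ v ℕ.< f → ∃ λ j → iter parent′ j (inj₂ v) ≡ inj₁ (owner v)
    climb-fuel (suc f) v (s≤s v<f) = helper _ (attached (owner v) v) refl
      where
      helper : ∀ z → Attached (owner v) v z → parent′ (inj₂ v) ≡ z → ∃ λ j → iter parent′ j (inj₂ v) ≡ inj₁ (owner v)
      helper _ (toHub _) e = 1 , e
      helper _ (toVertex w (cand , _)) e =
        let (j , reach) = climb-fuel f w (ℕP.≤-trans (candidate-< cand) v<f)
        in suc j , trans (iter-suc parent′ j (inj₂ v))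
                     (trans (cong (iter parent′ j) e) (trans reach (cong inj₁ (candidate-owner cand))))

  vertex-reaches-owner : ∀ v → ∃ λ j → iter parent′ j (inj₂ v) ≡ inj₁ (owner v)
  vertex-reaches-owner v = climb-fuel (suc (toℕ v)) v ℕP.≤-refl

  attach-reaches-hub : ∀ t x → ∃ λ j → iter parent′ j (attach t x) ≡ inj₁ t
  attach-reaches-hub t x = helper _ (attached t x)
    where
    helper : ∀ z → Attached t x z → ∃ λ j → iter parent′ j z ≡ inj₁ t
    helper _ (toHub _)               = 0 , refl
    helper _ (toVertex w (cand , _)) = let (j , reach) = vertex-reaches-owner w in
                                       j , trans reach (cong inj₁ (candidate-owner cand))

  hub-reaches-root : ∀ j t → iter par j t ≡ r → ∃ λ i → iter parent′ i (inj₁ t) ≡ inj₁ r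
  hub-reaches-root j t e with root? t
  ... | inj₁ refl = 0 , refl
  hub-reaches-root zero    t e | inj₂ t≢r = ⊥-elim (t≢r e)
  hub-reaches-root (suc j) t e | inj₂ t≢r =
    let (i , up) = hub-reaches-root j (par t) (trans (sym (iter-suc par j t)) e)
        (l , across) = attach-reaches-hub (par t) (repOf t)
    in suc (i + l) , trans (iter-suc parent′ (i + l) (inj₁ t)) (begin
      iter parent′ (i + l) (parent′ (inj₁ t))              ≡⟨ cong (iter parent′ (i + l)) (parent′-hub t≢r) ⟩
      iter parent′ (i + l) (attach (par t) (repOf t))     ≡⟨ iter-+ parent′ i l _ ⟩
      iter parent′ i (iter parent′ l (attach (par t) (repOf t))) ≡⟨ cong (iter parent′ i) across ⟩
      iter parent′ i (inj₁ (par t))                       ≡⟨ up ⟩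
      inj₁ r                                              ∎)
    where open ≡-Reasoning

  toRoot′ : ∀ z → ∃ λ j → iter parent′ j z ≡ inj₁ r
  toRoot′ (inj₁ t) = let (j , e) = toRoot T t in hub-reaches-root j t e
  toRoot′ (inj₂ v) =
    let (j , e) = vertex-reaches-owner v
        (j' , e') = toRoot T (owner v)
        (i , h) = hub-reaches-root j' (owner v) e'
    in i + j , trans (iter-+ parent′ i j _) (trans (cong (iter parent′ i) e) h)

  attach-above : ∀ {t x w} → Candidate t x w → ∃ λ w' → attach t x ≡ inj₂ w' × toℕ w ℕ.≤ toℕ w'
  attach-above {t} {x} {w} cand = helper _ (attached t x) refl
    where
    helper : ∀ z → Attached t x z → attach t x ≡ z → ∃ λ w' → attach t x ≡ inj₂ w' × toℕ w ℕ.≤ toℕ w'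
    helper _ (toHub none)               _ = ⊥-elim (none w cand)
    helper _ (toVertex w' (_ , greatest)) e = w' , e , greatest w cand

  attach-vertex-< : ∀ {v w} → attach (owner v) v ≡ inj₂ w → toℕ w ℕ.< toℕ v
  attach-vertex-< {v} = helper _ (attached (owner v) v)
    where
    helper : ∀ {w} z → Attached (owner v) v z → z ≡ inj₂ w → toℕ w ℕ.< toℕ v
    helper _ (toVertex w' (cand , _)) refl = candidate-< cand

  attach-base : ∀ {t x t' x'} → attach t x ≡ attach t' x' → t ≡ t'
  attach-base {t} {x} {t'} {x'} = helper _ _ (attached t x) (attached t' x')
    where
    helper : ∀ z z' → Attached t x z → Attached t' x' z' → z ≡ z' → t ≡ t'
    helper _ _ (toHub _) (toHub _) refl = refl
    helper _ _ (toVertex w (c , _)) (toVertex w (c' , _)) refl = trans (sym (candidate-owner c)) (candidate-owner c')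

  -- attach t x lies at or above v, whereas attach (owner v) v lies below v.
  candidate⇒attach≢ : ∀ {t x v} → Candidate t x v → attach t x ≢ attach (owner v) v
  candidate⇒attach≢ cand e =
    let (w' , at , v≤w') = attach-above cand
    in ℕP.<-irrefl refl (ℕP.<-≤-trans (attach-vertex-< (trans (sym e) at)) v≤w')

  attach-bag⊆β : ∀ t x → bag′ (attach t x) ⊆ β T t
  attach-bag⊆β t x = helper _ (attached t x)
    where
    helper : ∀ z → Attached t x z → bag′ z ⊆ β T t
    helper _ (toHub _) {y} y∈ with ∈bag′⁻ (inj₁ t) y y∈
    ... | inj₁ (refl , refl) = m∈β-root
    helper _ (toVertex w (cand , _)) {y} y∈ with ∈bag′⁻ (inj₂ w) y y∈
    ... | inj₂ (refl , _) = proj₁ cand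

  attach-bag⊆earlier : ∀ v → v ≢ m → bag′ (attach (owner v) v) ⊆ earlier v
  attach-bag⊆earlier v v≢m = helper _ (attached (owner v) v)
    where
    helper : ∀ z → Attached (owner v) v z → bag′ z ⊆ earlier v
    helper _ (toHub _) {y} y∈ with ∈bag′⁻ (inj₁ (owner v)) y y∈
    ... | inj₁ (o≡r , refl) =
      let v∈βr = subst (λ q → v ∈ β T q) (inj₁-injective o≡r) (∈β-owner v)
      in ∈earlier⁺ (subst (λ q → m ∈ β T q) (sym (inj₁-injective o≡r)) m∈β-root ,
                    ℕP.≤∧≢⇒< (m-least v v∈βr) (v≢m ∘ sym ∘ FP.toℕ-injective))
    helper _ (toVertex w (cand , _)) {y} y∈ with ∈bag′⁻ (inj₂ w) y y∈
    ... | inj₂ (refl , _) = ∈earlier⁺ (proj₁ cand , candidate-< cand)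

  frame′-attach : ∀ t x → frame′ (attach t x) ≡ Γ T t
  frame′-attach t x = helper _ (attached t x)
    where
    helper : ∀ z → Attached t x z → frame′ z ≡ Γ T t
    helper _ (toHub _)               = refl
    helper _ (toVertex w (cand , _)) = cong (Γ T) (candidate-owner cand)

  β⊆Sub′ : ∀ z x → x ∈ bag′ z → Sub′ z x
  β⊆Sub′ z x x∈ with ∈bag′⁻ z x x∈
  ... | inj₁ (refl , refl) = βSub-root m
  ... | inj₂ (refl , _)    = Comp-self x

  Sub-parent′ : ∀ z x → z ≢ inj₁ r → Sub′ z x → Sub′ (parent′ z) x
  Sub-parent′ (inj₁ t) x t≢r s =
    subst (λ q → Sub′ q x) (sym (parent′-hub (t≢r ∘ cong inj₁))) (helper _ (attached (par t) (repOf t)))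
    where
    helper : ∀ z → Attached (par t) (repOf t) z → Sub′ z x
    helper _ (toHub _) = βSub-parent t x s
    helper _ (toVertex w ((w∈ , _ , _ , comp) , _)) =
      let t≢r′ = t≢r ∘ cong inj₁ in
      βSub⊆Comp t w (repOf t) t≢r′ (βSub-avoids-vsep t w t≢r′ w∈) (proj₁ (repOf-component t t≢r′)) comp x s
  Sub-parent′ (inj₂ v) x _ s = helper _ (attached (owner v) v)
    where
    helper : ∀ z → Attached (owner v) v z → Sub′ z x
    helper _ (toHub _) = Comp⊆βSub-owner v x s
    helper _ (toVertex w (cand@(_ , _ , w≢v , cwv) , _)) =
      Comp-nested v w (sym (candidate-owner cand)) cwv (w≢v ∘ sym) x s

  parent-β∉Sub′ : ∀ z x → z ≢ spare → z ≢ inj₁ r → x ∈ bag′ (parent′ z) → ¬ Sub′ z x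
  parent-β∉Sub′ (inj₁ t) x _ t≢r x∈ =
    parent-β∉βSub t x (t≢r ∘ cong inj₁)
      (attach-bag⊆β (par t) (repOf t) (subst (λ q → x ∈ bag′ q) (parent′-hub (t≢r ∘ cong inj₁)) x∈))
  parent-β∉Sub′ (inj₂ v) x v≢m _ x∈ (x∉vsep , _) =
    x∉vsep (x∈p∪q⁺ (inj₂ (attach-bag⊆earlier v (v≢m ∘ cong inj₂) x∈)))

  private
    hub-candidate : ∀ c v x → c ≢ r → v ≢ m → v ∈ β T (par c) → βSub T c x → Comp v x →
                    Candidate (par c) (repOf c) v
    hub-candidate c v x c≢r v≢m v∈ sx cvx =
      let (s-rep , _) = repOf-component c c≢r in
      v∈ , v≢m , (λ v≡rep → parent-β∉βSub c v c≢r v∈ (subst (βSub T c) (sym v≡rep) s-rep)) ,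
      βSub⊆Comp c v x c≢r (βSub-avoids-vsep c v c≢r v∈) sx cvx (repOf c) s-rep

    vertex-candidate : ∀ v v' x → owner v ≡ owner v' → v ≢ m → toℕ v ℕ.< toℕ v' →
                       Comp v x → Comp v' x → Candidate (owner v') v' v
    vertex-candidate v v' x e v≢m v<v' cvx cv'x =
      subst (λ q → v ∈ β T q) e (∈β-owner v) , v≢m , (λ v≡v' → ℕP.<-irrefl (cong toℕ v≡v') v<v') ,
      Comp-overlap v v' x e v<v' cvx cv'x

    vertices-disjoint : ∀ v v' x → v ≢ m → v' ≢ m → attach (owner v) v ≡ attach (owner v') v' →
                        Comp v x → Comp v' x → v ≡ v'
    vertices-disjoint v v' x v≢m v'≢m e cvx cv'x with ℕP.<-cmp (toℕ v) (toℕ v')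
    ... | tri< v<v' _ _ = ⊥-elim (candidate⇒attach≢ (vertex-candidate v v' x (attach-base e) v≢m v<v' cvx cv'x) (sym e))
    ... | tri≈ _ v≡v' _ = FP.toℕ-injective v≡v'
    ... | tri> _ _ v'<v = ⊥-elim (candidate⇒attach≢ (vertex-candidate v' v x (sym (attach-base e)) v'≢m v'<v cv'x cvx) e)

  siblings-disjoint′ : ∀ y w x → y ≢ spare → w ≢ spare → y ≢ inj₁ r → w ≢ inj₁ r →
                       parent′ y ≡ parent′ w → Sub′ y x → Sub′ w x → y ≡ w
  siblings-disjoint′ (inj₁ c) (inj₁ c') x _ _ c≢r c'≢r e s s' =
    let pc≡ = trans (sym (parent′-hub (c≢r ∘ cong inj₁))) (trans e (parent′-hub (c'≢r ∘ cong inj₁))) in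
    cong inj₁ (βSub-siblings-disjoint c c' x (c≢r ∘ cong inj₁) (c'≢r ∘ cong inj₁) (attach-base pc≡) s s')
  siblings-disjoint′ (inj₁ c) (inj₂ v) x _ v≢m c≢r _ e s cvx =
    let c≢r′ = c≢r ∘ cong inj₁
        e′ = trans (sym (parent′-hub c≢r′)) e
        v∈ = subst (λ q → v ∈ β T q) (sym (attach-base e′)) (∈β-owner v)
    in ⊥-elim (candidate⇒attach≢ (hub-candidate c v x c≢r′ (v≢m ∘ cong inj₂) v∈ s cvx) e′)
  siblings-disjoint′ (inj₂ v) (inj₁ c) x v≢m _ _ c≢r e cvx s =
    sym (siblings-disjoint′ (inj₁ c) (inj₂ v) x (λ ()) v≢m c≢r (λ ()) (sym e) s cvx)
  siblings-disjoint′ (inj₂ v) (inj₂ v') x v≢m v'≢m _ _ e cvx cv'x =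
    cong inj₂ (vertices-disjoint v v' x (v≢m ∘ cong inj₂) (v'≢m ∘ cong inj₂) e cvx cv'x)

  Sub-component′ : ∀ z → z ≢ inj₁ r → IsStrongComponent D (sep′ z) (Sub′ z)
  Sub-component′ (inj₁ t) t≢r = proj₂ (proj₂ (proj₂ sc)) t (t≢r ∘ cong inj₁)
  Sub-component′ (inj₂ v) _   = v , self∉vsep v , Comp-self v , Comp-component v

  vsep⊆Γ-owner : ∀ v → vsep v ⊆ Γ T (owner v)
  vsep⊆Γ-owner v x∈ with x∈p∪q⁻ (sep (owner v)) (earlier v) x∈
  ... | inj₁ x∈sep = let (o≢r , x∈γ) = ∈sep⁻ (owner v) x∈sep in γ⊆Γ T (owner v) (owner v) (o≢r , inj₁ refl) x∈γ
  ... | inj₂ x∈ear = β⊆Γ T (owner v) (proj₁ (∈earlier⁻ x∈ear))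

  β⊆frame′ : ∀ z → bag′ z ⊆ frame′ z
  β⊆frame′ z {x} x∈ with ∈bag′⁻ z x x∈
  ... | inj₁ (refl , refl) = β⊆Γ T r m∈β-root
  ... | inj₂ (refl , _)    = β⊆Γ T (owner x) (∈β-owner x)

  γ⊆frame′ : ∀ z → z ≢ inj₁ r → sep′ z ⊆ frame′ z
  γ⊆frame′ (inj₁ t) t≢r = γ⊆Γ T t t (t≢r ∘ cong inj₁ , inj₁ refl)
  γ⊆frame′ (inj₂ v) _   = vsep⊆Γ-owner v

  child-γ⊆frame′ : ∀ z e → e ≢ inj₁ r → parent′ e ≡ z → sep′ e ⊆ frame′ z
  child-γ⊆frame′ _ (inj₁ c) c≢r refl {x} x∈ =
    let c≢r′ = c≢r ∘ cong inj₁ in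
    subst (λ q → x ∈ frame′ q) (sym (parent′-hub c≢r′))
      (subst (x ∈_) (sym (frame′-attach (par c) (repOf c))) (γ⊆Γ T (par c) c (c≢r′ , inj₂ refl) x∈))
  child-γ⊆frame′ _ (inj₂ v) _ refl {x} x∈ =
    subst (x ∈_) (sym (frame′-attach (owner v) v)) (vsep⊆Γ-owner v x∈)

  frame-size′ : ∀ z → ∣ frame′ z ∣ ℕ.≤ suc k
  frame-size′ (inj₁ t) = wd t
  frame-size′ (inj₂ v) = wd (owner v)

  cover′ : ∀ v → ∃ λ z → v ∈ bag′ z
  cover′ v with v ≟ m
  ... | yes refl = inj₁ r , m∈bag′-root
  ... | no v≢m   = inj₂ v , ∈bag′-vertex v≢m

  bags-disjoint′ : ∀ v z z' → v ∈ bag′ z → v ∈ bag′ z' → z ≡ z'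
  bags-disjoint′ v z z' v∈ v∈' with ∈bag′⁻ z v v∈ | ∈bag′⁻ z' v v∈'
  ... | inj₁ (refl , _)    | inj₁ (refl , _)    = refl
  ... | inj₂ (refl , _)    | inj₂ (refl , _)    = refl
  ... | inj₁ (_ , v≡m)     | inj₂ (_ , v≢m)     = ⊥-elim (v≢m v≡m)
  ... | inj₂ (_ , v≢m)     | inj₁ (_ , v≡m)     = ⊥-elim (v≢m v≡m)

  spare-bag : ∀ v → v ∉ bag′ spare
  spare-bag v v∈ with ∈bag′⁻ spare v v∈
  ... | inj₂ (refl , v≢m) = v≢m refl

  spareBlueprint : ∀ w → w ≢ m → SpareBlueprint D k Node
  spareBlueprint w w≢m = record
    { _≟ᴵ_ = ≡-dec _≟_ _≟_
    ; root = inj₁ r ; parent = parent′ ; parent-root = parent′-root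
    ; spare = spare ; anchor = inj₂ w
    ; root≢spare = λ () ; anchor≢root = λ () ; anchor≢spare = w≢m ∘ inj₂-injective
    ; parent≢spare = λ z _ → parent′≢spare z
    ; toRoot = λ z _ → toRoot′ z
    ; β = bag′ ; γ = sep′ ; spare-bag = spare-bag ; Sub = Sub′
    ; small = small′ ; cover = cover′ ; bags-disjoint = bags-disjoint′ ; root-bag = m , m∈bag′-root
    ; β⊆Sub = λ z x _ → β⊆Sub′ z x
    ; Sub-parent = λ z x _ → Sub-parent′ z x
    ; parent-β∉Sub = parent-β∉Sub′
    ; siblings-disjoint = siblings-disjoint′
    ; Sub-component = λ z _ → Sub-component′ z
    ; frame = frame′ ; frame-size = λ z _ → frame-size′ z
    ; β⊆frame = λ z _ → β⊆frame′ z
    ; γ⊆frame = λ z _ → γ⊆frame′ z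
    ; child-γ⊆frame = λ z e _ _ → child-γ⊆frame′ z e
    }
    where
    parent′-root : parent′ (inj₁ r) ≡ inj₁ r
    parent′-root with root? r
    ... | inj₁ _   = refl
    ... | inj₂ r≢r = ⊥-elim (r≢r refl)

∣p∣≤1 : ∀ {n} (u : Fin n) → (∀ v → v ≡ u) → ∀ (p : Subset n) → ∣ p ∣ ℕ.≤ 1
∣p∣≤1 u all≡u p = ℕP.≤-trans (p⊆q⇒∣p∣≤∣q∣ p⊆⁅u⁆) (ℕP.≤-reflexive (∣⁅x⁆∣≡1 u))
  where
  p⊆⁅u⁆ : p ⊆ ⁅ u ⁆
  p⊆⁅u⁆ {v} _ = subst (_∈ ⁅ u ⁆) (sym (all≡u v)) (x∈⁅x⁆ u)

-- When D has a single vertex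
-- every bag is already small; otherwise some vertex w ≠ m anchors the spare node.
corollary7p4 : (D : Digraph) (T : Decomposition D) (k : ℕ) →
    IsSCDTD T → WidthEq T k →
    Σ (Decomposition D) λ T' → IsSCDTD T' × WidthAtMost T' k × SmallBags T'
corollary7p4 D T k sc (wd , _) with FP.any? (λ w → ¬? (w ≟ VertexComponents.m T sc))
... | yes (w , w≢m) =
  FromBlueprint.result (reindex (FP.+↔⊎ {N T} {n D})
    (AbsorbSpare.blueprint (Construction.spareBlueprint T k sc wd w w≢m)))
... | no ¬w≢m = T , sc , wd , λ t → ∣p∣≤1 (VertexComponents.m T sc) all≡m (β T t)
  where
  all≡m : ∀ v → v ≡ VertexComponents.m T sc
  all≡m v with v ≟ VertexComponents.m T sc
  ... | yes v≡m = v≡m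
  ... | no v≢m  = ⊥-elim (¬w≢m (v , v≢m))
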